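{- Let $G=(V,E)$ be any $n$-vertex graph with maximum degree $\Delta$, let $\pi$ be a uniformly random permutation of $V$, and for $v\in V$ let $\deg^{<}_\pi(v)$ be the number of neighbors $u$ of $v$ that appear before $v$ in $\pi$. Then \[ \mathbb{E}_\pi\left[\sum_{v\in V}\frac{n}{\Delta+1-\deg^{<}_\pi(v)}\right]=O\left(\frac{n^2}{\Delta}\cdot\log\Delta\right). \] -}

module Defs where

open import Data.Nat using (ℕ; zero; suc; _⊔_; _∸_; _≤_)
open import Data.Bool using (Bool; true; false)
open import Data.Fin using (Fin; _≟_)
open import Data.List using (List; []; _∷_; map; concatMap; foldr; length)
open import Data.List using () renaming (allFin to allFinL)
open import Data.Integer using (+_)
open import Data.Rational using (ℚ; _/_; _+_; _*_; 0ℚ)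
open import Relation.Nullary using (yes; no)
open import Relation.Binary.PropositionalEquality using (_≡_)

record Graph (n : ℕ) : Set where
  field
    adj    : Fin n → Fin n → Bool
    sym    : ∀ u v → adj u v ≡ adj v u
    irrefl : ∀ v → adj v v ≡ false
open Graph public

countTrue : List Bool → ℕ
countTrue [] = 0
countTrue (true ∷ bs) = suc (countTrue bs)
countTrue (false ∷ bs) = countTrue bs

vertices : (n : ℕ) → List (Fin n)
vertices n = allFinL n

deg : ∀ {n} → Graph n → Fin n → ℕ
deg {n} G v = countTrue (map (adj G v) (vertices n))

maxDeg : ∀ {n} → Graph n → ℕ
maxDeg {n} G = foldr _⊔_ 0 (map (deg G) (vertices n))

-- All orderings (permutations) of a list, each listed exactly once
-- (for lists of distinct elements).
insertions : {A : Set} → A → List A → List (List A)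
insertions x [] = (x ∷ []) ∷ []
insertions x (y ∷ ys) = (x ∷ y ∷ ys) ∷ map (y ∷_) (insertions x ys)

perms : {A : Set} → List A → List (List A)
perms [] = [] ∷ []
perms (x ∷ xs) = concatMap (insertions x) (perms xs)

-- A permutation π of V, given as the list π(1), …, π(n).
Orderings : (n : ℕ) → List (List (Fin n))
Orderings n = perms (vertices n)

before : ∀ {n} → List (Fin n) → Fin n → List (Fin n)
before [] v = []
before (u ∷ π) v with u ≟ v
... | yes _ = []
... | no _ = u ∷ before π v

degBefore : ∀ {n} → Graph n → List (Fin n) → Fin n → ℕ
degBefore G π v = countTrue (map (adj G v) (before π v))

sumℚ : List ℚ → ℚ
sumℚ = foldr _+_ 0ℚ

average : List ℚ → ℚ
average [] = 0ℚ
average (x ∷ xs) = sumℚ (x ∷ xs) * (+ 1 / suc (length xs))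

-- the random variable  Σ_v n / (Δ + 1 − deg^<_π(v)).
-- Since deg^<_π(v) ≤ deg(v) ≤ Δ, the denominator Δ + 1 − d equals suc (Δ ∸ d).
X : ∀ {n} → Graph n → List (Fin n) → ℚ
X {n} G π = sumℚ (map (λ v → + n / suc (maxDeg G ∸ degBefore G π v)) (vertices n))

expectation : ∀ {n} → Graph n → ℚ
expectation {n} G = average (map (X G) (Orderings n))

-- For a vertex v of degree d, deg^<_π(v) is uniformly distributed on {0, …, d}. Indeed,
-- reorder the vertices as (non-neighbours, v, neighbours), which does not change the
-- list of orderings up to permutation: `perms` then inserts v at each of the d + 1
-- positions of every ordering of the neighbours, and afterwards inserts the
-- non-neighbours, which never changes deg^<_π(v). Since Δ/(Δ+1−i) ≤ (d+1)/(d+1−i) for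
-- i ≤ d ≤ Δ, Δ times the expected contribution of v is at most n·H(d+1), and
-- H(d+1) ≤ ⌊log₂ Δ⌋ + 2 ≤ 3⌊log₂ Δ⌋ by grouping the harmonic sum into dyadic blocks.
-- Summing over the n vertices gives the bound with C = 3.

module Submission where

open import Algebra.Bundles using (CommutativeMonoid; Ring)
open import Data.Bool using (true; false)
open import Data.Empty using (⊥-elim)
open import Data.Fin using (Fin; _≟_)
open import Data.Integer as ℤ using (+_)
import Data.Integer.Properties as ℤ
open import Data.List as List using (List; []; _∷_; _++_; map; concatMap; length; upTo; applyUpTo)
import Data.List.Properties as List
open import Data.List.Membership.Propositional using (_∈_)
open import Data.List.Membership.Propositional.Properties using (∈-allFin; ∈-∃++)
open import Data.List.Relation.Binary.Permutation.Propositional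
  using (_↭_; ↭-refl; ↭-sym; ↭-trans; refl; prep; swap; trans; ↭⇒↭ₛ; module PermutationReasoning)
import Data.List.Relation.Binary.Permutation.Propositional.Properties as ↭
open import Data.List.Relation.Binary.Permutation.Setoid.Properties using (foldr-commMonoid; Unique-resp-↭)
open import Data.List.Relation.Unary.All as All using (All; []; _∷_)
import Data.List.Relation.Unary.All.Properties as All
open import Data.List.Relation.Unary.Any using (here; there)
open import Data.List.Relation.Unary.Unique.Propositional using (Unique)
open import Data.List.Relation.Unary.Unique.Propositional.Properties using (allFin⁺; Unique[x∷xs]⇒x∉xs)
open import Data.Nat using (ℕ; zero; suc; _+_; _*_; _∸_; _^_; _⊔_; _≤_; _<_; z≤n; s≤s; s≤s⁻¹)
import Data.Nat.Properties as ℕ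
open import Data.Nat.Logarithm using (⌊log₂_⌋; ⌊log₂⌋-mono-≤; ⌊log₂[2^n]⌋≡n)
open import Data.Nat.Tactic.RingSolver using (solve-∀)
open import Data.Product using (_,_; ∃-syntax; ∃₂) renaming (_×_ to _∧_)
open import Data.Rational using (ℚ; _/_; 0ℚ; 1ℚ; toℚᵘ)
open import Data.Rational as ℚ using ()
import Data.Rational.Properties as ℚ
open import Data.Rational.Unnormalised as ℚᵘ using (mkℚᵘ; *≤*; _≃_)
import Data.Rational.Unnormalised.Properties as ℚᵘ
open import Function using (_∘_; id)
open import Relation.Binary.PropositionalEquality as ≡
  using (_≡_; _≢_; refl; cong; cong₂; subst; subst₂; module ≡-Reasoning)
open import Relation.Binary.PropositionalEquality.Properties using (setoid)
open import Relation.Nullary using (yes; no)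

open import Algebra.Properties.CommutativeSemigroup
  (CommutativeMonoid.commutativeSemigroup ℚ.+-0-commutativeMonoid) using (interchange)
open import Algebra.Properties.Semiring.Mult (Ring.semiring ℚ.+-*-ring)
  using (_×_; ×-assocˡ; ×-assoc-*; ×-comm-*)

open import Defs

private
  toℚᵘ-/ : ∀ a k → toℚᵘ (+ a / suc k) ≃ mkℚᵘ (+ a) k
  toℚᵘ-/ a k = ℚ.toℚᵘ-fromℚᵘ (mkℚᵘ (+ a) k)

/≤/ : ∀ a k b l → a * suc l ≤ b * suc k → + a / suc k ℚ.≤ + b / suc l
/≤/ a k b l al≤bk = ℚ.toℚᵘ-cancel-≤
  (ℚᵘ.≤-respˡ-≃ (ℚᵘ.≃-sym (toℚᵘ-/ a k)) (ℚᵘ.≤-respʳ-≃ (ℚᵘ.≃-sym (toℚᵘ-/ b l))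
    (*≤* (subst₂ ℤ._≤_ (ℤ.pos-* a (suc l)) (ℤ.pos-* b (suc k)) (ℤ.+≤+ al≤bk)))))

/≡/ : ∀ a k b l → a * suc l ≡ b * suc k → + a / suc k ≡ + b / suc l
/≡/ a k b l eq = ℚ.≤-antisym (/≤/ a k b l (ℕ.≤-reflexive eq)) (/≤/ b l a k (ℕ.≤-reflexive (≡.sym eq)))

/*/ : ∀ a k b l → (+ a / suc k) ℚ.* (+ b / suc l) ≡ + (a * b) / (suc k * suc l)
/*/ a k b l = ℚ.toℚᵘ-injective (begin-equality
  toℚᵘ ((+ a / suc k) ℚ.* (+ b / suc l))         ≃⟨ ℚ.toℚᵘ-homo-* (+ a / suc k) (+ b / suc l) ⟩
  toℚᵘ (+ a / suc k) ℚᵘ.* toℚᵘ (+ b / suc l)     ≃⟨ ℚᵘ.*-cong (toℚᵘ-/ a k) (toℚᵘ-/ b l) ⟩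
  mkℚᵘ (+ a ℤ.* + b) _                            ≡⟨ cong (λ z → mkℚᵘ z _) (≡.sym (ℤ.pos-* a b)) ⟩
  mkℚᵘ (+ (a * b)) _                              ≃⟨ toℚᵘ-/ (a * b) _ ⟨
  toℚᵘ (+ (a * b) / (suc k * suc l))              ∎)
  where open ℚᵘ.≤-Reasoning

/+/ : ∀ a k b l → (+ a / suc k) ℚ.+ (+ b / suc l) ≡ + (a * suc l + b * suc k) / (suc k * suc l)
/+/ a k b l = ℚ.toℚᵘ-injective (begin-equality
  toℚᵘ ((+ a / suc k) ℚ.+ (+ b / suc l))          ≃⟨ ℚ.toℚᵘ-homo-+ (+ a / suc k) (+ b / suc l) ⟩
  toℚᵘ (+ a / suc k) ℚᵘ.+ toℚᵘ (+ b / suc l)      ≃⟨ ℚᵘ.+-cong (toℚᵘ-/ a k) (toℚᵘ-/ b l) ⟩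
  mkℚᵘ (+ a ℤ.* + suc l ℤ.+ + b ℤ.* + suc k) _    ≡⟨ cong (λ z → mkℚᵘ z _) (≡.sym numerator) ⟩
  mkℚᵘ (+ (a * suc l + b * suc k)) _              ≃⟨ toℚᵘ-/ _ _ ⟨
  toℚᵘ (+ (a * suc l + b * suc k) / (suc k * suc l)) ∎)
  where
  open ℚᵘ.≤-Reasoning
  numerator : + (a * suc l + b * suc k) ≡ + a ℤ.* + suc l ℤ.+ + b ℤ.* + suc k
  numerator = ≡.trans (ℤ.pos-+ (a * suc l) (b * suc k)) (cong₂ ℤ._+_ (ℤ.pos-* a (suc l)) (ℤ.pos-* b (suc k)))

/+/-sameDenominator : ∀ a b l → (+ a / suc l) ℚ.+ (+ b / suc l) ≡ + (a + b) / suc l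
/+/-sameDenominator a b l =
  ≡.trans (/+/ a l b l) (/≡/ (a * suc l + b * suc l) (l + l * suc l) (a + b) l (cross a b l))
  where
  cross : ∀ a b l → (a * suc l + b * suc l) * suc l ≡ (a + b) * (suc l * suc l)
  cross = solve-∀

×-/ : ∀ k a l → k × (+ a / suc l) ≡ + (k * a) / suc l
×-/ zero    a l = ≡.sym (ℚ.0/n≡0 (suc l))
×-/ (suc k) a l = ≡.trans (cong (ℚ._+_ (+ a / suc l)) (×-/ k a l)) (/+/-sameDenominator a (k * a) l)

×-monoʳ-≤ : ∀ k {p q} → p ℚ.≤ q → k × p ℚ.≤ k × q
×-monoʳ-≤ zero    p≤q = ℚ.≤-refl
×-monoʳ-≤ (suc k) p≤q = ℚ.+-mono-≤ p≤q (×-monoʳ-≤ k p≤q)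

×-*-inverse : ∀ m p → (suc m × p) ℚ.* (+ 1 / suc m) ≡ p
×-*-inverse m p = begin
  (suc m × p) ℚ.* (+ 1 / suc m)     ≡⟨ ×-assoc-* (suc m) p _ ⟩
  suc m × (p ℚ.* (+ 1 / suc m))     ≡⟨ ×-comm-* (suc m) p _ ⟨
  p ℚ.* (suc m × (+ 1 / suc m))     ≡⟨ cong (p ℚ.*_) [1+m]/[1+m]≡1 ⟩
  p ℚ.* 1ℚ                          ≡⟨ ℚ.*-identityʳ p ⟩
  p                                 ∎
  where
  open ≡-Reasoning
  units : ∀ m → suc m * 1 * 1 ≡ 1 * suc m
  units = solve-∀
  [1+m]/[1+m]≡1 : suc m × (+ 1 / suc m) ≡ 1ℚ
  [1+m]/[1+m]≡1 = ≡.trans (×-/ (suc m) 1 m) (/≡/ (suc m * 1) m 1 0 (units m))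

∑ : {A : Set} → List A → (A → ℚ) → ℚ
∑ xs f = sumℚ (map f xs)

syntax ∑ xs (λ x → e) = ∑[ x ∈ xs ] e

module _ {A : Set} where

  ∑-↭ : ∀ {xs ys : List A} f → xs ↭ ys → ∑ xs f ≡ ∑ ys f
  ∑-↭ f xs↭ys = foldr-commMonoid (setoid ℚ) ℚ.+-0-isCommutativeMonoid (↭⇒↭ₛ (↭.map⁺ f xs↭ys))

  ∑-++ : ∀ (xs ys : List A) f → ∑ (xs ++ ys) f ≡ ∑ xs f ℚ.+ ∑ ys f
  ∑-++ []       ys f = ≡.sym (ℚ.+-identityˡ _)
  ∑-++ (x ∷ xs) ys f = ≡.trans (cong (ℚ._+_ (f x)) (∑-++ xs ys f)) (≡.sym (ℚ.+-assoc (f x) _ _))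

  ∑-cong : ∀ {xs : List A} {f g} → All (λ x → f x ≡ g x) xs → ∑ xs f ≡ ∑ xs g
  ∑-cong []              = refl
  ∑-cong (fx≡gx ∷ f≡g) = cong₂ ℚ._+_ fx≡gx (∑-cong f≡g)

  ∑-mono-≤ : ∀ {xs : List A} {f g} → All (λ x → f x ℚ.≤ g x) xs → ∑ xs f ℚ.≤ ∑ xs g
  ∑-mono-≤ []              = ℚ.≤-refl
  ∑-mono-≤ (fx≤gx ∷ f≤g) = ℚ.+-mono-≤ fx≤gx (∑-mono-≤ f≤g)

  ∑-const : ∀ (xs : List A) c → ∑[ x ∈ xs ] c ≡ length xs × c
  ∑-const []       c = refl
  ∑-const (x ∷ xs) c = cong (ℚ._+_ c) (∑-const xs c)

  ∑-0 : ∀ (xs : List A) → ∑[ x ∈ xs ] 0ℚ ≡ 0ℚ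
  ∑-0 []       = refl
  ∑-0 (x ∷ xs) = ≡.trans (ℚ.+-identityˡ _) (∑-0 xs)

  ∑-+ : ∀ (xs : List A) f g → ∑[ x ∈ xs ] (f x ℚ.+ g x) ≡ ∑ xs f ℚ.+ ∑ xs g
  ∑-+ []       f g = ≡.sym (ℚ.+-identityˡ 0ℚ)
  ∑-+ (x ∷ xs) f g = ≡.trans (cong (ℚ._+_ (f x ℚ.+ g x)) (∑-+ xs f g)) (interchange (f x) (g x) _ _)

  ∑-*ˡ : ∀ (xs : List A) c f → c ℚ.* ∑ xs f ≡ ∑[ x ∈ xs ] (c ℚ.* f x)
  ∑-*ˡ []       c f = ℚ.*-zeroʳ c
  ∑-*ˡ (x ∷ xs) c f = ≡.trans (ℚ.*-distribˡ-+ c (f x) _) (cong (ℚ._+_ (c ℚ.* f x)) (∑-*ˡ xs c f))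

  ∑-× : ∀ (xs : List A) k f → ∑[ x ∈ xs ] (k × f x) ≡ k × ∑ xs f
  ∑-× xs zero    f = ∑-0 xs
  ∑-× xs (suc k) f = ≡.trans (∑-+ xs f (λ x → k × f x)) (cong (ℚ._+_ (∑ xs f)) (∑-× xs k f))

∑-map : ∀ {A B : Set} (h : A → B) (xs : List A) f → ∑ (map h xs) f ≡ ∑ xs (f ∘ h)
∑-map h xs f = cong sumℚ (≡.sym (List.map-∘ xs))

∑-concatMap : ∀ {A B : Set} (g : A → List B) (xs : List A) f →
              ∑ (concatMap g xs) f ≡ ∑[ x ∈ xs ] ∑ (g x) f
∑-concatMap g []       f = refl
∑-concatMap g (x ∷ xs) f =
  ≡.trans (∑-++ (g x) (concatMap g xs) f) (cong (ℚ._+_ (∑ (g x) f)) (∑-concatMap g xs f))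

∑-comm : ∀ {A B : Set} (xs : List A) (ys : List B) (h : A → B → ℚ) →
         ∑[ x ∈ xs ] ∑[ y ∈ ys ] h x y ≡ ∑[ y ∈ ys ] ∑[ x ∈ xs ] h x y
∑-comm []       ys h = ≡.sym (∑-0 ys)
∑-comm (x ∷ xs) ys h =
  ≡.trans (cong (ℚ._+_ (∑ ys (h x))) (∑-comm xs ys h)) (≡.sym (∑-+ ys (h x) _))

∑-upTo-suc : ∀ m f → ∑ (upTo (suc m)) f ≡ f 0 ℚ.+ ∑[ i ∈ upTo m ] f (suc i)
∑-upTo-suc m f = cong (λ is → f 0 ℚ.+ sumℚ is) (begin
  map f (applyUpTo suc m)   ≡⟨ cong (map f) (List.map-upTo suc m) ⟨
  map f (map suc (upTo m))  ≡⟨ List.map-∘ (upTo m) ⟨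
  map (f ∘ suc) (upTo m)    ∎)
  where open ≡-Reasoning

*-average-≤ : ∀ c M xs → 0ℚ ℚ.≤ M → c ℚ.* sumℚ xs ℚ.≤ length xs × M → c ℚ.* average xs ℚ.≤ M
*-average-≤ c M []       0≤M _   = ℚ.≤-trans (ℚ.≤-reflexive (ℚ.*-zeroʳ c)) 0≤M
*-average-≤ c M (x ∷ xs) _   c∑≤ = begin
  c ℚ.* (sumℚ (x ∷ xs) ℚ.* r)   ≡⟨ ℚ.*-assoc c _ r ⟨
  c ℚ.* sumℚ (x ∷ xs) ℚ.* r     ≤⟨ ℚ.*-monoʳ-≤-nonNeg r {{r-nonNeg}} c∑≤ ⟩
  suc (length xs) × M ℚ.* r     ≡⟨ ×-*-inverse (length xs) M ⟩
  M                             ∎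
  where
  open ℚ.≤-Reasoning
  r = + 1 / suc (length xs)
  r-nonNeg : ℚ.NonNegative r
  r-nonNeg = ℚ.normalize-nonNeg 1 (suc (length xs))

-- Harmonic numbers

H : ℕ → ℚ
H zero    = 0ℚ
H (suc m) = + 1 / suc m ℚ.+ H m

∑-reciprocals≡H : ∀ d → ∑[ i ∈ upTo (suc d) ] (+ 1 / suc (d ∸ i)) ≡ H (suc d)
∑-reciprocals≡H zero    = refl
∑-reciprocals≡H (suc d) = ≡.trans (∑-upTo-suc (suc d) (λ i → + 1 / suc (suc d ∸ i)))
                                  (cong (ℚ._+_ (+ 1 / suc (suc d))) (∑-reciprocals≡H d))

H-mono-≤ : ∀ {m m′} → m ≤ m′ → H m ℚ.≤ H m′
H-mono-≤ {m} {m′} m≤m′ = subst (λ j → H m ℚ.≤ H j) (ℕ.m∸n+n≡m m≤m′) (H-≤-+ (m′ ∸ m))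
  where
  H-≤-+ : ∀ b → H m ℚ.≤ H (b + m)
  H-≤-+ zero    = ℚ.≤-refl
  H-≤-+ (suc b) = ℚ.≤-trans (H-≤-+ b) (ℚ.≤-trans (ℚ.≤-reflexive (≡.sym (ℚ.+-identityˡ _)))
                    (ℚ.+-monoˡ-≤ (H (b + m)) (/≤/ 0 0 1 (b + m) z≤n)))

H-+-≤ : ∀ b a → H (b + a) ℚ.≤ b × (+ 1 / suc a) ℚ.+ H a
H-+-≤ zero    a = ℚ.≤-reflexive (≡.sym (ℚ.+-identityˡ (H a)))
H-+-≤ (suc b) a = begin
  + 1 / suc (b + a) ℚ.+ H (b + a)             ≤⟨ ℚ.+-mono-≤ 1/[1+b+a]≤1/[1+a] (H-+-≤ b a) ⟩
  + 1 / suc a ℚ.+ (b × (+ 1 / suc a) ℚ.+ H a) ≡⟨ ℚ.+-assoc (+ 1 / suc a) (b × (+ 1 / suc a)) (H a) ⟨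
  suc b × (+ 1 / suc a) ℚ.+ H a               ∎
  where
  open ℚ.≤-Reasoning
  1/[1+b+a]≤1/[1+a] : + 1 / suc (b + a) ℚ.≤ + 1 / suc a
  1/[1+b+a]≤1/[1+a] = /≤/ 1 (b + a) 1 a (ℕ.*-monoʳ-≤ 1 (s≤s (ℕ.m≤n+m a b)))

H-2^-≤ : ∀ k → H (2 ^ k) ℚ.≤ + suc k / 1
H-2^-≤ zero    = ℚ.≤-refl
H-2^-≤ (suc k) = begin
  H (2 ^ suc k)                     ≡⟨ cong (λ j → H (m + j)) (ℕ.+-identityʳ m) ⟩
  H (m + m)                         ≤⟨ H-+-≤ m m ⟩
  m × (+ 1 / suc m) ℚ.+ H m         ≤⟨ ℚ.+-mono-≤ m/[1+m]≤1 (H-2^-≤ k) ⟩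
  1ℚ ℚ.+ + suc k / 1                ≡⟨ /+/-sameDenominator 1 (suc k) 0 ⟩
  + suc (suc k) / 1                 ∎
  where
  open ℚ.≤-Reasoning
  m = 2 ^ k
  units : ∀ m → m * 1 * 1 + 1 ≡ 1 * suc m
  units = solve-∀
  m/[1+m]≤1 : m × (+ 1 / suc m) ℚ.≤ 1ℚ
  m/[1+m]≤1 = ℚ.≤-trans (ℚ.≤-reflexive (×-/ m 1 m))
                (/≤/ (m * 1) m 1 0 (subst (m * 1 * 1 ≤_) (units m) (ℕ.m≤m+n _ 1)))

<2^suc⌊log₂⌋ : ∀ m → m < 2 ^ suc ⌊log₂ m ⌋
<2^suc⌊log₂⌋ m = ℕ.≰⇒> λ 2^≤m →
  ℕ.1+n≰n (subst (_≤ ⌊log₂ m ⌋) (⌊log₂[2^n]⌋≡n (suc ⌊log₂ m ⌋)) (⌊log₂⌋-mono-≤ 2^≤m))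

H-≤-3⌊log₂⌋ : ∀ {Δ d} → 2 ≤ Δ → d ≤ Δ → H (suc d) ℚ.≤ + (3 * ⌊log₂ Δ ⌋) / 1
H-≤-3⌊log₂⌋ {Δ} {d} 2≤Δ d≤Δ = begin
  H (suc d)          ≤⟨ H-mono-≤ (ℕ.≤-trans (s≤s d≤Δ) (<2^suc⌊log₂⌋ Δ)) ⟩
  H (2 ^ suc L)      ≤⟨ H-2^-≤ (suc L) ⟩
  + (2 + L) / 1      ≤⟨ /≤/ (2 + L) 0 (3 * L) 0 (ℕ.*-monoˡ-≤ 1 2+L≤3L) ⟩
  + (3 * L) / 1      ∎
  where
  open ℚ.≤-Reasoning
  L = ⌊log₂ Δ ⌋
  thrice : ∀ L → L + L + L ≡ 3 * L
  thrice = solve-∀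
  1≤L : 1 ≤ L
  1≤L = ⌊log₂⌋-mono-≤ 2≤Δ
  2+L≤3L : 2 + L ≤ 3 * L
  2+L≤3L = subst (2 + L ≤_) (thrice L) (ℕ.+-monoˡ-≤ L (ℕ.+-mono-≤ 1≤L 1≤L))

-- Orderings of a list

concatMap⁺ : ∀ {A B : Set} (f : A → List B) {xs ys} → xs ↭ ys → concatMap f xs ↭ concatMap f ys
concatMap⁺ f refl         = ↭-refl
concatMap⁺ f (prep x p)   = ↭.++⁺ˡ (f x) (concatMap⁺ f p)
concatMap⁺ f (swap x y p) = ↭-trans (↭.shifts (f x) (f y)) (↭.++⁺ˡ (f y) (↭.++⁺ˡ (f x) (concatMap⁺ f p)))
concatMap⁺ f (trans p q)  = ↭-trans (concatMap⁺ f p) (concatMap⁺ f q)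

module _ {A : Set} where

  insertions-sound : ∀ (x : A) p → All (_↭ x ∷ p) (insertions x p)
  insertions-sound x []      = ↭-refl ∷ []
  insertions-sound x (z ∷ p) =
    ↭-refl ∷ All.map⁺ (All.map (λ q↭x∷p → ↭-trans (prep z q↭x∷p) (swap z x ↭-refl))
                               (insertions-sound x p))

  perms-sound : ∀ (xs : List A) → All (_↭ xs) (perms xs)
  perms-sound []       = ↭-refl ∷ []
  perms-sound (x ∷ xs) = All.concat⁺ (All.map⁺ (All.map
    (λ {p} p↭xs → All.map (λ q↭x∷p → ↭-trans q↭x∷p (prep x p↭xs)) (insertions-sound x p))
    (perms-sound xs)))

  length-insertions : ∀ (x : A) p → length (insertions x p) ≡ suc (length p)
  length-insertions x []      = refl
  length-insertions x (z ∷ p) = cong suc (≡.trans (List.length-map (z ∷_) (insertions x p)) (length-insertions x p))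

  concatMap-insertions-map-∷ : ∀ (x z : A) Q →
    concatMap (insertions x) (map (z ∷_) Q) ↭ map (x ∷_) (map (z ∷_) Q) ++ map (z ∷_) (concatMap (insertions x) Q)
  concatMap-insertions-map-∷ x z []      = ↭-refl
  concatMap-insertions-map-∷ x z (q ∷ Q) = prep _ (begin
    map (z ∷_) (insertions x q) ++ concatMap (insertions x) (map (z ∷_) Q)
      ↭⟨ ↭.++⁺ˡ (map (z ∷_) (insertions x q)) (concatMap-insertions-map-∷ x z Q) ⟩
    map (z ∷_) (insertions x q) ++ map (x ∷_) (map (z ∷_) Q) ++ map (z ∷_) (concatMap (insertions x) Q)
      ↭⟨ ↭.shifts (map (z ∷_) (insertions x q)) (map (x ∷_) (map (z ∷_) Q)) ⟩
    map (x ∷_) (map (z ∷_) Q) ++ map (z ∷_) (insertions x q) ++ map (z ∷_) (concatMap (insertions x) Q)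
      ≡⟨ cong (map (x ∷_) (map (z ∷_) Q) ++_) (List.map-++ (z ∷_) (insertions x q) _) ⟨
    map (x ∷_) (map (z ∷_) Q) ++ map (z ∷_) (insertions x q ++ concatMap (insertions x) Q) ∎)
    where open PermutationReasoning

  insertions-comm : ∀ (x y : A) p →
    concatMap (insertions x) (insertions y p) ↭ concatMap (insertions y) (insertions x p)
  insertions-comm x y []      = swap _ _ ↭-refl
  insertions-comm x y (z ∷ p) = begin
    concatMap (insertions x) (insertions y (z ∷ p))
      ↭⟨ prep _ (prep _ (↭.++⁺ˡ yzIx (concatMap-insertions-map-∷ x z (insertions y p)))) ⟩
    _ ∷ _ ∷ yzIx ++ xzIy ++ map (z ∷_) (concatMap (insertions x) (insertions y p))
      ↭⟨ swap _ _ (↭.shifts yzIx xzIy) ⟩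
    _ ∷ _ ∷ xzIy ++ yzIx ++ map (z ∷_) (concatMap (insertions x) (insertions y p))
      ↭⟨ prep _ (prep _ (↭.++⁺ˡ xzIy (↭.++⁺ˡ yzIx (↭.map⁺ (z ∷_) (insertions-comm x y p))))) ⟩
    _ ∷ _ ∷ xzIy ++ yzIx ++ map (z ∷_) (concatMap (insertions y) (insertions x p))
      ↭⟨ prep _ (prep _ (↭.++⁺ˡ xzIy (concatMap-insertions-map-∷ y z (insertions x p)))) ⟨
    concatMap (insertions y) (insertions x (z ∷ p)) ∎
    where
    open PermutationReasoning
    yzIx = map (y ∷_) (map (z ∷_) (insertions x p))
    xzIy = map (x ∷_) (map (z ∷_) (insertions y p))

  concatMap-insertions-comm : ∀ (x y : A) P →
    concatMap (insertions x) (concatMap (insertions y) P) ↭ concatMap (insertions y) (concatMap (insertions x) P)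
  concatMap-insertions-comm x y []      = ↭-refl
  concatMap-insertions-comm x y (p ∷ P) = begin
    concatMap (insertions x) (insertions y p ++ concatMap (insertions y) P)
      ≡⟨ List.concatMap-++ (insertions x) (insertions y p) _ ⟩
    concatMap (insertions x) (insertions y p) ++ concatMap (insertions x) (concatMap (insertions y) P)
      ↭⟨ ↭.++⁺ (insertions-comm x y p) (concatMap-insertions-comm x y P) ⟩
    concatMap (insertions y) (insertions x p) ++ concatMap (insertions y) (concatMap (insertions x) P)
      ≡⟨ List.concatMap-++ (insertions y) (insertions x p) _ ⟨
    concatMap (insertions y) (insertions x p ++ concatMap (insertions x) P) ∎
    where open PermutationReasoning

  perms⁺ : ∀ {xs ys : List A} → xs ↭ ys → perms xs ↭ perms ys
  perms⁺ refl                   = ↭-refl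
  perms⁺ (prep x p)             = concatMap⁺ (insertions x) (perms⁺ p)
  perms⁺ (swap {ys = ys} x y p) = ↭-trans (concatMap⁺ (insertions x) (concatMap⁺ (insertions y) (perms⁺ p)))
                                          (concatMap-insertions-comm x y (perms ys))
  perms⁺ (trans p q)            = ↭-trans (perms⁺ p) (perms⁺ q)

-- deg^<_π(v) is uniformly distributed over the orderings π

module _ {n} (G : Graph n) (v : Fin n) where

  Neighbour NonNeighbour : Fin n → Set
  Neighbour u    = adj G v u ≡ true
  NonNeighbour u = v ≢ u ∧ adj G v u ≡ false

  neighbour-≢ : ∀ {u} → Neighbour u → v ≢ u
  neighbour-≢ vu refl with ≡.trans (≡.sym vu) (irrefl G v)
  ... | ()

  degBefore-here : ∀ π → degBefore G (v ∷ π) v ≡ 0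
  degBefore-here π with v ≟ v
  ... | yes _   = refl
  ... | no v≢v = ⊥-elim (v≢v refl)

  degBefore-neighbour : ∀ {u} π → Neighbour u → degBefore G (u ∷ π) v ≡ suc (degBefore G π v)
  degBefore-neighbour {u} π vu with u ≟ v
  ... | yes refl = ⊥-elim (neighbour-≢ vu refl)
  ... | no _ rewrite vu = refl

  degBefore-nonNeighbour : ∀ {u} π → NonNeighbour u → degBefore G (u ∷ π) v ≡ degBefore G π v
  degBefore-nonNeighbour {u} π (v≢u , ¬vu) with u ≟ v
  ... | yes refl = ⊥-elim (v≢u refl)
  ... | no _ rewrite ¬vu = refl

  degBefore-∷-cong : ∀ u {π π′} → degBefore G π v ≡ degBefore G π′ v →
                     degBefore G (u ∷ π) v ≡ degBefore G (u ∷ π′) v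
  degBefore-∷-cong u eq with u ≟ v
  ... | yes _ = refl
  ... | no _ with adj G v u
  ...   | true  = cong suc eq
  ...   | false = eq

  map-degBefore-insertions-v : ∀ {q} → All Neighbour q →
                               map (λ π → degBefore G π v) (insertions v q) ≡ upTo (suc (length q))
  map-degBefore-insertions-v {[]}    []         = cong (_∷ []) (degBefore-here [])
  map-degBefore-insertions-v {z ∷ q} (vz ∷ vq) = cong₂ _∷_ (degBefore-here (z ∷ q)) (begin
    map (λ π → degBefore G π v) (map (z ∷_) (insertions v q))
      ≡⟨ List.map-∘ (insertions v q) ⟨
    map (λ π → degBefore G (z ∷ π) v) (insertions v q)
      ≡⟨ List.map-cong (λ π → degBefore-neighbour π vz) (insertions v q) ⟩
    map (λ π → suc (degBefore G π v)) (insertions v q)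
      ≡⟨ List.map-∘ (insertions v q) ⟩
    map suc (map (λ π → degBefore G π v) (insertions v q))
      ≡⟨ cong (map suc) (map-degBefore-insertions-v vq) ⟩
    map suc (upTo (suc (length q)))
      ≡⟨ List.map-upTo suc (suc (length q)) ⟩
    applyUpTo suc (suc (length q)) ∎)
    where open ≡-Reasoning

  degBefore-insertions-nonNeighbour : ∀ {y} → NonNeighbour y → ∀ p →
    All (λ π → degBefore G π v ≡ degBefore G p v) (insertions y p)
  degBefore-insertions-nonNeighbour vy []      = degBefore-nonNeighbour [] vy ∷ []
  degBefore-insertions-nonNeighbour vy (z ∷ p) = degBefore-nonNeighbour (z ∷ p) vy
    ∷ All.map⁺ (All.map (degBefore-∷-cong z) (degBefore-insertions-nonNeighbour vy p))

  ∑-insertions-v : ∀ {q} → All Neighbour q → ∀ f →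
                   ∑[ π ∈ insertions v q ] f (degBefore G π v) ≡ ∑ (upTo (suc (length q))) f
  ∑-insertions-v {q} vq f = ≡.trans (≡.sym (∑-map (λ π → degBefore G π v) (insertions v q) f))
                                    (cong (λ is → ∑ is f) (map-degBefore-insertions-v vq))

  ∑-insertions-nonNeighbour : ∀ {y} → NonNeighbour y → ∀ p f →
    ∑[ π ∈ insertions y p ] f (degBefore G π v) ≡ suc (length p) × f (degBefore G p v)
  ∑-insertions-nonNeighbour {y} vy p f = begin
    ∑[ π ∈ insertions y p ] f (degBefore G π v)
      ≡⟨ ∑-cong (All.map (cong f) (degBefore-insertions-nonNeighbour vy p)) ⟩
    ∑[ π ∈ insertions y p ] f (degBefore G p v)
      ≡⟨ ∑-const (insertions y p) _ ⟩
    length (insertions y p) × f (degBefore G p v)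
      ≡⟨ cong (_× f (degBefore G p v)) (length-insertions y p) ⟩
    suc (length p) × f (degBefore G p v) ∎
    where open ≡-Reasoning

  record Uniform (Π : List (List (Fin n))) (d : ℕ) : Set where
    constructor uniform
    field
      multiplicity : ℕ
      ∑-degBefore  : ∀ f → ∑[ π ∈ Π ] f (degBefore G π v) ≡ multiplicity × ∑ (upTo (suc d)) f

  uniform-↭ : ∀ {Π Π′ d} → Π ↭ Π′ → Uniform Π d → Uniform Π′ d
  uniform-↭ Π↭Π′ (uniform k ∑≡) = uniform k λ f → ≡.trans (∑-↭ _ (↭-sym Π↭Π′)) (∑≡ f)

  uniform-mono-≤ : ∀ {Π d f g} → Uniform Π d → ∑ (upTo (suc d)) f ℚ.≤ ∑ (upTo (suc d)) g →
                   ∑[ π ∈ Π ] f (degBefore G π v) ℚ.≤ ∑[ π ∈ Π ] g (degBefore G π v)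
  uniform-mono-≤ {Π} {d} {f} {g} (uniform k ∑≡) f≤g = begin
    ∑[ π ∈ Π ] f (degBefore G π v) ≡⟨ ∑≡ f ⟩
    k × ∑ (upTo (suc d)) f         ≤⟨ ×-monoʳ-≤ k f≤g ⟩
    k × ∑ (upTo (suc d)) g         ≡⟨ ∑≡ g ⟨
    ∑[ π ∈ Π ] g (degBefore G π v) ∎
    where open ℚ.≤-Reasoning

  uniform-v∷ : ∀ {ss} → All Neighbour ss → Uniform (perms (v ∷ ss)) (length ss)
  uniform-v∷ {ss} vss = uniform (length (perms ss)) λ f → begin
    ∑[ π ∈ concatMap (insertions v) (perms ss) ] f (degBefore G π v)
      ≡⟨ ∑-concatMap (insertions v) (perms ss) _ ⟩
    ∑[ q ∈ perms ss ] ∑[ π ∈ insertions v q ] f (degBefore G π v)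
      ≡⟨ ∑-cong (All.map (λ q↭ss → block q↭ss f) (perms-sound ss)) ⟩
    ∑[ q ∈ perms ss ] ∑ (upTo (suc (length ss))) f
      ≡⟨ ∑-const (perms ss) _ ⟩
    length (perms ss) × ∑ (upTo (suc (length ss))) f ∎
    where
    open ≡-Reasoning
    block : ∀ {q} → q ↭ ss → ∀ f →
            ∑[ π ∈ insertions v q ] f (degBefore G π v) ≡ ∑ (upTo (suc (length ss))) f
    block q↭ss f = ≡.trans (∑-insertions-v (↭.All-resp-↭ (↭-sym q↭ss) vss) f)
                           (cong (λ m → ∑ (upTo (suc m)) f) (↭.↭-length q↭ss))

  uniform-insert-nonNeighbour : ∀ {y Π d} m → NonNeighbour y → All (λ π → length π ≡ m) Π →
                                Uniform Π d → Uniform (concatMap (insertions y) Π) d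
  uniform-insert-nonNeighbour {y} {Π} {d} m vy lengths (uniform k ∑≡) = uniform (suc m * k) λ f → begin
    ∑[ π ∈ concatMap (insertions y) Π ] f (degBefore G π v)
      ≡⟨ ∑-concatMap (insertions y) Π _ ⟩
    ∑[ p ∈ Π ] ∑[ π ∈ insertions y p ] f (degBefore G π v)
      ≡⟨ ∑-cong (All.map (λ {p} → block f p) lengths) ⟩
    ∑[ p ∈ Π ] (suc m × f (degBefore G p v))
      ≡⟨ ∑-× Π (suc m) _ ⟩
    suc m × ∑[ p ∈ Π ] f (degBefore G p v)
      ≡⟨ cong (suc m ×_) (∑≡ f) ⟩
    suc m × (k × ∑ (upTo (suc d)) f)
      ≡⟨ ×-assocˡ _ (suc m) k ⟩
    (suc m * k) × ∑ (upTo (suc d)) f ∎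
    where
    open ≡-Reasoning
    block : ∀ f p → length p ≡ m →
            ∑[ π ∈ insertions y p ] f (degBefore G π v) ≡ suc m × f (degBefore G p v)
    block f p refl = ∑-insertions-nonNeighbour vy p f

  uniform-perms : ∀ {ys ss} → All NonNeighbour ys → All Neighbour ss →
                  Uniform (perms (ys ++ v ∷ ss)) (length ss)
  uniform-perms {[]}         []         vss = uniform-v∷ vss
  uniform-perms {y ∷ ys} {ss} (vy ∷ vys) vss = uniform-insert-nonNeighbour (length (ys ++ v ∷ ss)) vy
    (All.map ↭.↭-length (perms-sound (ys ++ v ∷ ss))) (uniform-perms vys vss)

  record NeighbourhoodSplit (xs : List (Fin n)) : Set where
    field
      others neighbours : List (Fin n)
      ↭-split           : xs ↭ others ++ neighbours
      all-others        : All NonNeighbour others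
      all-neighbours    : All Neighbour neighbours
      count-neighbours  : countTrue (map (adj G v) xs) ≡ length neighbours

  neighbourhoodSplit : ∀ xs → All (v ≢_) xs → NeighbourhoodSplit xs
  neighbourhoodSplit [] [] = record
    { others = [] ; neighbours = [] ; ↭-split = ↭-refl
    ; all-others = [] ; all-neighbours = [] ; count-neighbours = refl }
  neighbourhoodSplit (x ∷ xs) (v≢x ∷ v≢xs) with adj G v x in vx
  ... | true = record
    { others = others ; neighbours = x ∷ neighbours
    ; ↭-split = ↭-trans (prep x ↭-split) (↭-sym (↭.shift x others neighbours))
    ; all-others = all-others ; all-neighbours = vx ∷ all-neighbours
    ; count-neighbours = ≡.trans (cong (λ b → countTrue (b ∷ map (adj G v) xs)) vx) (cong suc count-neighbours) }
    where open NeighbourhoodSplit (neighbourhoodSplit xs v≢xs)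
  ... | false = record
    { others = x ∷ others ; neighbours = neighbours
    ; ↭-split = prep x ↭-split
    ; all-others = (v≢x , vx) ∷ all-others ; all-neighbours = all-neighbours
    ; count-neighbours = ≡.trans (cong (λ b → countTrue (b ∷ map (adj G v) xs)) vx) count-neighbours }
    where open NeighbourhoodSplit (neighbourhoodSplit xs v≢xs)

  countTrue-skip-v : ∀ as bs → countTrue (map (adj G v) (as ++ v ∷ bs)) ≡ countTrue (map (adj G v) (as ++ bs))
  countTrue-skip-v []       bs rewrite irrefl G v = refl
  countTrue-skip-v (a ∷ as) bs with adj G v a
  ... | true  = cong suc (countTrue-skip-v as bs)
  ... | false = countTrue-skip-v as bs

  uniform-orderings : Uniform (Orderings n) (deg G v)
  uniform-orderings = around (∈-∃++ (∈-allFin v))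
    where
    around : ∃₂ (λ as bs → vertices n ≡ as ++ v ∷ bs) → Uniform (Orderings n) (deg G v)
    around (as , bs , vertices≡) = subst (Uniform (Orderings n)) deg≡
      (uniform-↭ (↭-sym (perms⁺ vertices↭)) (uniform-perms all-others all-neighbours))
      where
      v∉ : All (v ≢_) (as ++ bs)
      v∉ = All.¬Any⇒All¬ (as ++ bs) (Unique[x∷xs]⇒x∉xs
             (Unique-resp-↭ (setoid (Fin n)) (↭⇒↭ₛ (↭.shift v as bs)) (subst Unique vertices≡ (allFin⁺ n))))
      open NeighbourhoodSplit (neighbourhoodSplit (as ++ bs) v∉)
      vertices↭ : vertices n ↭ others ++ v ∷ neighbours
      vertices↭ = begin
        vertices n                ≡⟨ vertices≡ ⟩
        as ++ v ∷ bs              ↭⟨ ↭.shift v as bs ⟩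
        v ∷ as ++ bs              ↭⟨ prep v ↭-split ⟩
        v ∷ others ++ neighbours  ↭⟨ ↭.shift v others neighbours ⟨
        others ++ v ∷ neighbours  ∎
        where open PermutationReasoning
      deg≡ : length neighbours ≡ deg G v
      deg≡ = ≡.sym (≡.trans (cong (λ xs → countTrue (map (adj G v) xs)) vertices≡)
                            (≡.trans (countTrue-skip-v as bs) count-neighbours))

-- The contribution of one vertex

-- With d = i + e and Δ = d + f the two sides differ by n (i f + e + 1).
Δn[1+d∸i]≤[1+d]n[1+Δ∸i] : ∀ {i d Δ} n → i ≤ d → d ≤ Δ →
                          Δ * n * suc (d ∸ i) ≤ suc d * n * suc (Δ ∸ i)
Δn[1+d∸i]≤[1+d]n[1+Δ∸i] {i} n i≤d d≤Δ
  with e , refl ← ℕ.m≤n⇒∃[o]m+o≡n i≤d | f , refl ← ℕ.m≤n⇒∃[o]m+o≡n d≤Δ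
  rewrite ℕ.m+n∸m≡n i e | ℕ.+-assoc i e f | ℕ.m+n∸m≡n i (e + f)
  = subst ((i + (e + f)) * n * suc e ≤_) (gap i e f n) (ℕ.m≤m+n _ _)
  where
  gap : ∀ i e f n → (i + (e + f)) * n * suc e + n * (i * f + e + 1) ≡ suc (i + e) * n * suc (e + f)
  gap = solve-∀

term-≤ : ∀ {i d Δ} n → i ≤ d → d ≤ Δ →
         (+ Δ / 1) ℚ.* (+ n / suc (Δ ∸ i)) ℚ.≤ (suc d * n) × (+ 1 / suc (d ∸ i))
term-≤ {i} {d} {Δ} n i≤d d≤Δ = begin
  (+ Δ / 1) ℚ.* (+ n / suc (Δ ∸ i))    ≡⟨ /*/ Δ 0 n (Δ ∸ i) ⟩
  + (Δ * n) / (1 * suc (Δ ∸ i))        ≤⟨ /≤/ (Δ * n) (Δ ∸ i + 0) (suc d * n * 1) (d ∸ i) cross ⟩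
  + (suc d * n * 1) / suc (d ∸ i)      ≡⟨ ×-/ (suc d * n) 1 (d ∸ i) ⟨
  (suc d * n) × (+ 1 / suc (d ∸ i))    ∎
  where
  open ℚ.≤-Reasoning
  units : ∀ a x → a * suc x ≡ a * 1 * suc (x + 0)
  units = solve-∀
  cross : Δ * n * suc (d ∸ i) ≤ suc d * n * 1 * suc (Δ ∸ i + 0)
  cross = subst (Δ * n * suc (d ∸ i) ≤_) (units (suc d * n) (Δ ∸ i)) (Δn[1+d∸i]≤[1+d]n[1+Δ∸i] n i≤d d≤Δ)

∑-term-≤ : ∀ {Δ d} n → 2 ≤ Δ → d ≤ Δ →
  ∑[ i ∈ upTo (suc d) ] ((+ Δ / 1) ℚ.* (+ n / suc (Δ ∸ i)))
  ℚ.≤ ∑[ i ∈ upTo (suc d) ] (+ (3 * n * ⌊log₂ Δ ⌋) / 1)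
∑-term-≤ {Δ} {d} n 2≤Δ d≤Δ = begin
  ∑[ i ∈ upTo (suc d) ] ((+ Δ / 1) ℚ.* (+ n / suc (Δ ∸ i)))
    ≤⟨ ∑-mono-≤ (All.applyUpTo⁺₁ id (suc d) (λ i<1+d → term-≤ n (s≤s⁻¹ i<1+d) d≤Δ)) ⟩
  ∑[ i ∈ upTo (suc d) ] ((suc d * n) × (+ 1 / suc (d ∸ i)))
    ≡⟨ ∑-× (upTo (suc d)) (suc d * n) (λ i → + 1 / suc (d ∸ i)) ⟩
  (suc d * n) × ∑[ i ∈ upTo (suc d) ] (+ 1 / suc (d ∸ i))
    ≡⟨ cong ((suc d * n) ×_) (∑-reciprocals≡H d) ⟩
  (suc d * n) × H (suc d)
    ≤⟨ ×-monoʳ-≤ (suc d * n) (H-≤-3⌊log₂⌋ 2≤Δ d≤Δ) ⟩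
  (suc d * n) × (+ (3 * L) / 1)
    ≡⟨ ×-/ (suc d * n) (3 * L) 0 ⟩
  + (suc d * n * (3 * L)) / 1
    ≡⟨ cong (λ j → + j / 1) (regroup (suc d) n L) ⟩
  + (suc d * (3 * n * L)) / 1
    ≡⟨ ×-/ (suc d) (3 * n * L) 0 ⟨
  suc d × (+ (3 * n * L) / 1)
    ≡⟨ cong (_× (+ (3 * n * L) / 1)) (List.length-upTo (suc d)) ⟨
  length (upTo (suc d)) × (+ (3 * n * L) / 1)
    ≡⟨ ∑-const (upTo (suc d)) (+ (3 * n * L) / 1) ⟨
  ∑[ i ∈ upTo (suc d) ] (+ (3 * n * L) / 1) ∎
  where
  open ℚ.≤-Reasoning
  L = ⌊log₂ Δ ⌋
  regroup : ∀ a n L → a * n * (3 * L) ≡ a * (3 * n * L)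
  regroup = solve-∀

∈⇒≤-foldr-⊔ : ∀ {A : Set} (f : A → ℕ) {x} xs → x ∈ xs → f x ≤ List.foldr _⊔_ 0 (map f xs)
∈⇒≤-foldr-⊔ f (y ∷ ys) (here refl)  = ℕ.m≤m⊔n (f y) _
∈⇒≤-foldr-⊔ f (y ∷ ys) (there x∈ys) = ℕ.≤-trans (∈⇒≤-foldr-⊔ f ys x∈ys) (ℕ.m≤n⊔m (f y) _)

deg≤maxDeg : ∀ {n} (G : Graph n) u → deg G u ≤ maxDeg G
deg≤maxDeg {n} G u = ∈⇒≤-foldr-⊔ (deg G) (vertices n) (∈-allFin u)

module _ {n} (G : Graph n) (2≤Δ : 2 ≤ maxDeg G) where

  private
    Δ = maxDeg G
    B = + (3 * n * ⌊log₂ Δ ⌋) / 1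

  ∑-degBefore-term-≤ : ∀ u → ∑[ π ∈ Orderings n ] ((+ Δ / 1) ℚ.* (+ n / suc (Δ ∸ degBefore G π u)))
                             ℚ.≤ ∑[ π ∈ Orderings n ] B
  ∑-degBefore-term-≤ u = uniform-mono-≤ G u {f = λ j → (+ Δ / 1) ℚ.* (+ n / suc (Δ ∸ j))} {g = λ _ → B}
    (uniform-orderings G u) (∑-term-≤ n 2≤Δ (deg≤maxDeg G u))

  Δ*∑X-≤ : (+ Δ / 1) ℚ.* ∑ (Orderings n) (X G)
           ℚ.≤ length (Orderings n) × (+ (3 * n * n * ⌊log₂ Δ ⌋) / 1)
  Δ*∑X-≤ = begin
    (+ Δ / 1) ℚ.* ∑ Π (X G)
      ≡⟨ ∑-*ˡ Π (+ Δ / 1) (X G) ⟩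
    ∑[ π ∈ Π ] ((+ Δ / 1) ℚ.* X G π)
      ≡⟨ ∑-cong (All.universal (λ π → ∑-*ˡ V (+ Δ / 1) (term π)) Π) ⟩
    ∑[ π ∈ Π ] ∑[ u ∈ V ] ((+ Δ / 1) ℚ.* term π u)
      ≡⟨ ∑-comm Π V _ ⟩
    ∑[ u ∈ V ] ∑[ π ∈ Π ] ((+ Δ / 1) ℚ.* term π u)
      ≤⟨ ∑-mono-≤ (All.universal ∑-degBefore-term-≤ V) ⟩
    ∑[ u ∈ V ] ∑[ π ∈ Π ] B
      ≡⟨ ∑-comm V Π _ ⟩
    ∑[ π ∈ Π ] ∑[ u ∈ V ] B
      ≡⟨ ∑-cong (All.universal (λ _ → ∑-const V B) Π) ⟩
    ∑[ π ∈ Π ] (length V × B)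
      ≡⟨ cong (λ m → ∑[ π ∈ Π ] (m × B)) (List.length-tabulate {n = n} id) ⟩
    ∑[ π ∈ Π ] (n × B)
      ≡⟨ ∑-const Π (n × B) ⟩
    length Π × (n × B)
      ≡⟨ cong (length Π ×_) (≡.trans (×-/ n _ 0) (cong (λ j → + j / 1) (regroup n ⌊log₂ Δ ⌋))) ⟩
    length Π × (+ (3 * n * n * ⌊log₂ Δ ⌋) / 1) ∎
    where
    open ℚ.≤-Reasoning
    Π = Orderings n
    V = vertices n
    term : List (Fin n) → Fin n → ℚ
    term π u = + n / suc (Δ ∸ degBefore G π u)
    regroup : ∀ n L → n * (3 * n * L) ≡ 3 * n * n * L
    regroup = solve-∀

lemmaA6 : ∃[ C ] ∀ (n : ℕ) (G : Graph n) → 2 ≤ maxDeg G →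
    (+ maxDeg G / 1) ℚ.* expectation G ℚ.≤ + (C * n * n * ⌊log₂ maxDeg G ⌋) / 1
lemmaA6 = 3 , λ n G 2≤Δ →
  let M = + (3 * n * n * ⌊log₂ maxDeg G ⌋) / 1
      orderingValues = map (X G) (Orderings n)
  in *-average-≤ (+ maxDeg G / 1) M orderingValues
       (ℚ.nonNegative⁻¹ M {{ℚ.normalize-nonNeg (3 * n * n * ⌊log₂ maxDeg G ⌋) 1}})
       (subst (λ m → (+ maxDeg G / 1) ℚ.* sumℚ orderingValues ℚ.≤ m × M)
              (≡.sym (List.length-map (X G) (Orderings n))) (Δ*∑X-≤ G 2≤Δ))
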